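{- Let $n>k>0$, $\mu=(n-k,1^k)$ and $\nu=(n-k+1,1^{k-1})$, and let $1<i<n$. Let $u$ be a permutation of $[n]$ such that at least one of the following holds: $D_i^{\mu}(u)=u$; or $u_k\notin\{i-1,i,i+1\}$; or $u_j\in\{i-1,i,i+1\}$ for some $j<k$. Then $\phi_k(D_i^{\mu}(u))=D_i^{\nu}(\phi_k(u))$.
   Context: Permutations of $[n]$ are words $w=w_1\cdots w_n$. $\gamma_x$: for a word $v=v_1\cdots v_m$ with distinct letters and a letter $x$ not in $v$, break $v$ into consecutive blocks, namely if $v_1<x$ break immediately before each index $j$ with $v_j<x$, otherwise break before each index $j$ with $v_j>x$; $\gamma_x(v)$ moves the first letter of each block to the end of its block. For $k\in[n]$, $\phi_k(w)=w_1\cdots w_k\,\gamma_{w_k}(w_{k+1}\cdots w_n)$. Fillings: a partition $\mu$ of $n$ is drawn in French convention (longest row at the bottom); $w$ fills the cells of $\mu$ left to right within each row, rows taken from top to bottom. For two cells $c,d$ with $c$ earlier in this reading order, they form a potential $\mu$-descent if one lies directly above the other in the same column, and a potential $\mu$-inversion if they lie in the same row, or $d$ lies in the row immediately below $c$ and strictly to the left of $c$. Involutions, for $1<i<n$: if $i$ lies positionally between $i-1$ and $i+1$ in $w$, then $d_i(w)=\widetilde d_i(w)=D_i^\mu(w)=w$. Otherwise, $d_i$ interchanges $i$ with whichever $j\in\{i-1,i+1\}$ is farther from $i$ in $w$; and $\widetilde d_i$ cyclically rotates the letters $i-1,i,i+1$ in their three positions so that $i$ moves to the other side of $i-1$ and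 $i+1$ (if, left to right, these positions hold $i,a,b$ they come to hold $a,b,i$, and conversely). Then $D_i^\mu(w)=d_i(w)$ if the cells containing $i$ and that $j$ form neither a potential $\mu$-descent nor a potential $\mu$-inversion, and $D_i^\mu(w)=\widetilde d_i(w)$ otherwise. -}

module Defs where

open import Data.Nat using (ℕ; zero; suc; _∸_; _<ᵇ_; _≡ᵇ_; ∣_-_∣)
open import Data.Bool using (Bool; true; false; if_then_else_; _∧_; _∨_; not)
open import Data.List using (List; []; _∷_; _++_; map; upTo; take; drop; replicate)
open import Data.Product using (_×_; _,_)

-- Words are lists of natural numbers; letters of a permutation of [n] are 1..n.
-- Positions in a word are 0-indexed internally; letterAt is 1-indexed (w_j).

nthD : {A : Set} → A → List A → ℕ → A
nthD d []       _       = d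
nthD d (x ∷ xs) zero    = x
nthD d (x ∷ xs) (suc j) = nthD d xs j

-- w_j (1-indexed), default 0 when out of range
letterAt : List ℕ → ℕ → ℕ
letterAt w j = nthD 0 w (j ∸ 1)

-- 0-indexed position of the first occurrence of x in w (length w if absent)
pos : ℕ → List ℕ → ℕ
pos x []       = zero
pos x (y ∷ ys) = if x ≡ᵇ y then zero else suc (pos x ys)

-- gamBlocks P a ys : a is the first letter of the current block (pending),
-- ys the rest of the word; a new block starts at each letter satisfying P.
gamBlocks : (ℕ → Bool) → ℕ → List ℕ → List ℕ
gamBlocks P a []       = a ∷ []
gamBlocks P a (y ∷ ys) = if P y then a ∷ gamBlocks P y ys else y ∷ gamBlocks P a ys

γ : ℕ → List ℕ → List ℕ
γ x []        = []
γ x (v₁ ∷ vs) =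
  if v₁ <ᵇ x then gamBlocks (λ y → y <ᵇ x) v₁ vs
             else gamBlocks (λ y → x <ᵇ y) v₁ vs

φ : ℕ → List ℕ → List ℕ
φ k w = take k w ++ γ (letterAt w k) (drop k w)

-- Fillings of a partition μ = μ₁ ≥ μ₂ ≥ … (list, μ₁ = bottom row, French)
-- Cells are (row , column), rows numbered 1,2,… from the bottom,
-- columns 1,2,… from the left.

rowCells : ℕ → ℕ → List (ℕ × ℕ)
rowCells r m = map (λ c → (r , suc c)) (upTo m)

-- reading order: rows from top to bottom, left to right within a row
cellsFrom : ℕ → List ℕ → List (ℕ × ℕ)
cellsFrom r []       = []
cellsFrom r (m ∷ ms) = cellsFrom (suc r) ms ++ rowCells r m

cells : List ℕ → List (ℕ × ℕ)
cells μ = cellsFrom 1 μ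

-- cell filled by the letter at 0-indexed position p
cellAt : List ℕ → ℕ → ℕ × ℕ
cellAt μ p = nthD (0 , 0) (cells μ) p

-- c earlier than d in reading order
potDescent : ℕ × ℕ → ℕ × ℕ → Bool
potDescent (r₁ , c₁) (r₂ , c₂) = (r₁ ≡ᵇ suc r₂) ∧ (c₁ ≡ᵇ c₂)

potInversion : ℕ × ℕ → ℕ × ℕ → Bool
potInversion (r₁ , c₁) (r₂ , c₂) = (r₁ ≡ᵇ r₂) ∨ ((r₁ ≡ᵇ suc r₂) ∧ (c₂ <ᵇ c₁))

attacks : List ℕ → ℕ → ℕ → Bool
attacks μ p q =
  if p <ᵇ q then (potDescent (cellAt μ p) (cellAt μ q) ∨ potInversion (cellAt μ p) (cellAt μ q))
            else (potDescent (cellAt μ q) (cellAt μ p) ∨ potInversion (cellAt μ q) (cellAt μ p))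

hook : ℕ → ℕ → List ℕ
hook a b = a ∷ replicate b 1

swapL : ℕ → ℕ → ℕ → ℕ
swapL a b x = if x ≡ᵇ a then b else (if x ≡ᵇ b then a else x)

cyc : ℕ → ℕ → ℕ → ℕ → ℕ
cyc a b c x = if x ≡ᵇ a then b else (if x ≡ᵇ b then c else (if x ≡ᵇ c then a else x))

between : ℕ → List ℕ → Bool
between i w =
  let pm = pos (i ∸ 1) w ; p0 = pos i w ; pp = pos (suc i) w in
  ((pm <ᵇ p0) ∧ (p0 <ᵇ pp)) ∨ ((pp <ᵇ p0) ∧ (p0 <ᵇ pm))

farther : ℕ → List ℕ → ℕ
farther i w =
  if ∣ pos (i ∸ 1) w - pos i w ∣ <ᵇ ∣ pos (suc i) w - pos i w ∣ then suc i else i ∸ 1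

d : ℕ → List ℕ → List ℕ
d i w = if between i w then w else map (swapL i (farther i w)) w

-- d̃: if positions (left to right) hold i,a,b they come to hold a,b,i
-- (letter substitution i↦a, a↦b, b↦i); if they hold a,b,i they come to
-- hold i,a,b (letter substitution a↦i, i↦b, b↦a).
dt : ℕ → List ℕ → List ℕ
dt i w =
  if between i w then w else
  (let pm = pos (i ∸ 1) w ; p0 = pos i w ; pp = pos (suc i) w
       a  = if pm <ᵇ pp then i ∸ 1 else suc i   -- letter at the smaller of the other two positions
       b  = if pm <ᵇ pp then suc i else i ∸ 1
   in if p0 <ᵇ pm then map (cyc i a b) w
                  else map (cyc a i b) w)

D : List ℕ → ℕ → List ℕ → List ℕ
D μ i w =
  if between i w then w else
  (if attacks μ (pos i w) (pos (farther i w) w) then dt i w else d i w)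

-- Unless i lies between i - 1 and i + 1 (where D is the identity on both sides), D^μ_i renames
-- the letters i - 1, i, i + 1 of u among themselves, and the renaming depends only on their
-- relative order and on whether the cells of i and of its farther neighbour attack in μ.
-- Write u = A ++ x ∷ V with x = u_k, so that φ_k(u) = A ++ x ∷ γ_x(V).  The map γ_x keeps the
-- relative order of letters lying on one side of x, and it commutes with any renaming that moves
-- no letter of V across x; passing from μ to ν only changes whether position k attacks a later
-- position.  Hence both sides agree once the order of the three letters, that one attack and the
-- sides of x are preserved.  This happens when x is not one of the three letters, when all three
-- occur among u_1, …, u_k, and in the remaining case allowed by the hypothesis: the letters are
-- y, x, t with y before and t after position k.  There x ≠ i (else i would be between), so x is
-- an extreme letter, i and its farther neighbour are y and t, and D swaps y and t, which lie on
-- the same side of x.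
module Submission where

open import Data.Bool using (Bool; true; false; if_then_else_; _∧_; _∨_)
open import Data.Bool.Properties using (T-≡)
open import Data.Empty using (⊥-elim)
open import Data.List using (List; []; _∷_; _++_; map; upTo; applyUpTo; length; replicate; filterᵇ)
open import Data.List.Properties using (map-++; length-map; length-++; length-upTo; ++-assoc; ∷-injective)
open import Data.List.Membership.Propositional using (_∈_; _∉_; find)
open import Data.List.Membership.Propositional.Properties using (∈-++⁺ʳ; ∈-++⁺ˡ; ∈-map⁺; ∈-upTo⁺)
open import Data.List.Relation.Unary.Any using (here; there)
import Data.List.Relation.Unary.All as All
open import Data.List.Relation.Unary.All using (all?)
open import Data.List.Relation.Unary.All.Properties using (¬All⇒Any¬)
open import Data.List.Relation.Unary.AllPairs using (_∷_)
open import Data.List.Relation.Unary.Unique.Propositional using (Unique)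
open import Data.List.Relation.Unary.Unique.Propositional.Properties using (map⁺; upTo⁺)
open import Data.List.Relation.Binary.Permutation.Propositional using (_↭_; ↭-sym; ↭⇒↭ₛ)
open import Data.List.Relation.Binary.Permutation.Propositional.Properties using (∈-resp-↭; ↭-length)
open import Data.List.Relation.Binary.Permutation.Setoid.Properties using (Unique-resp-↭)
open import Data.Nat using (ℕ; zero; suc; _∸_; _+_; _<_; _≤_; _<ᵇ_; _≡ᵇ_; z≤n; s≤s; ∣_-_∣; _<?_; _≟_)
open import Data.Nat.Properties
open import Data.List.Membership.DecPropositional _≟_ using (_∈?_)
open import Data.Product using (Σ; ∃₂; _×_; _,_; proj₁; proj₂; swap)
open import Data.Sum using (_⊎_; inj₁; inj₂)
import Data.Sum as Sum
open import Function using (_∘_)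
open import Function.Bundles using (Equivalence)
open import Relation.Binary.Definitions using (tri<; tri≈; tri>)
open import Relation.Binary.PropositionalEquality
open import Relation.Nullary using (yes; no)

open import Defs

true≢false : true ≢ false
true≢false ()

<ᵇ-true : ∀ {a b} → a < b → (a <ᵇ b) ≡ true
<ᵇ-true a<b = Equivalence.to T-≡ (<⇒<ᵇ a<b)

<ᵇ-false : ∀ {a b} → b ≤ a → (a <ᵇ b) ≡ false
<ᵇ-false {a} {b} b≤a with a <ᵇ b in eq
... | false = refl
... | true  = ⊥-elim (<⇒≱ (<ᵇ⇒< a b (Equivalence.from T-≡ eq)) b≤a)

<ᵇ-asym : ∀ {a b} → (a <ᵇ b) ≡ true → (b <ᵇ a) ≡ false
<ᵇ-asym {a} {b} eq = <ᵇ-false (<⇒≤ (<ᵇ⇒< a b (Equivalence.from T-≡ eq)))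

≡ᵇ-refl : ∀ a → (a ≡ᵇ a) ≡ true
≡ᵇ-refl a = Equivalence.to T-≡ (≡⇒≡ᵇ a a refl)

≡ᵇ-false : ∀ {a b} → a ≢ b → (a ≡ᵇ b) ≡ false
≡ᵇ-false {a} {b} a≢b with a ≡ᵇ b in eq
... | false = refl
... | true  = ⊥-elim (a≢b (≡ᵇ⇒≡ a b (Equivalence.from T-≡ eq)))

≡ᵇ-true⇒≡ : ∀ {a b} → (a ≡ᵇ b) ≡ true → a ≡ b
≡ᵇ-true⇒≡ {a} {b} eq = ≡ᵇ⇒≡ a b (Equivalence.from T-≡ eq)

before : ℕ → ℕ → List ℕ → Bool
before a b w = pos a w <ᵇ pos b w

∉⇒≢ : ∀ {L : List ℕ} {z a} → z ∉ L → a ∈ L → z ≢ a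
∉⇒≢ z∉ a∈ refl = z∉ a∈

∈-tail : ∀ {a q} {P : List ℕ} → a ∈ q ∷ P → (a ≡ᵇ q) ≡ false → a ∈ P
∈-tail {a = a} (here refl) eq = ⊥-elim (true≢false (trans (sym (≡ᵇ-refl a)) eq))
∈-tail (there a∈P) _ = a∈P

before-++ : ∀ {a b} P {W W′} → (a ∈ P ⊎ b ∈ P) ⊎ before a b W ≡ before a b W′ →
            before a b (P ++ W) ≡ before a b (P ++ W′)
before-++ [] (inj₁ (inj₁ ()))
before-++ [] (inj₁ (inj₂ ()))
before-++ [] (inj₂ eq) = eq
before-++ {a = a} {b = b} (q ∷ P) h with a ≡ᵇ q in ea | b ≡ᵇ q in eb
... | true  | true  = refl
... | true  | false = refl
... | false | true  = refl
... | false | false = before-++ P (Sum.map₁ (Sum.map (λ a∈ → ∈-tail a∈ ea) (λ b∈ → ∈-tail b∈ eb)) h)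

before-filterᵇ : ∀ {a b} (Q : ℕ → Bool) w → Q a ≡ true → Q b ≡ true →
                 before a b (filterᵇ Q w) ≡ before a b w
before-filterᵇ Q [] qa qb = refl
before-filterᵇ {a} {b} Q (y ∷ w) qa qb with Q y in qy
... | true with a ≡ᵇ y | b ≡ᵇ y
...   | true  | true  = refl
...   | true  | false = refl
...   | false | true  = refl
...   | false | false = before-filterᵇ Q w qa qb
before-filterᵇ {a} {b} Q (y ∷ w) qa qb | false
  rewrite ≡ᵇ-false {a} {y} (λ { refl → true≢false (trans (sym qa) qy) })
        | ≡ᵇ-false {b} {y} (λ { refl → true≢false (trans (sym qb) qy) }) = before-filterᵇ Q w qa qb

before-filterᵇ-cong : ∀ {a b} (Q : ℕ → Bool) w w′ → Q a ≡ true → Q b ≡ true →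
                      filterᵇ Q w ≡ filterᵇ Q w′ → before a b w ≡ before a b w′
before-filterᵇ-cong Q w w′ qa qb eq =
  trans (sym (before-filterᵇ Q w qa qb)) (trans (cong (before _ _) eq) (before-filterᵇ Q w′ qa qb))

filterᵇ-reject : ∀ (Q : ℕ → Bool) {y} ys → Q y ≡ false → filterᵇ Q (y ∷ ys) ≡ filterᵇ Q ys
filterᵇ-reject Q ys qy rewrite qy = refl

filterᵇ-∷-cong : ∀ (Q : ℕ → Bool) y {ys zs} → filterᵇ Q ys ≡ filterᵇ Q zs →
                 filterᵇ Q (y ∷ ys) ≡ filterᵇ Q (y ∷ zs)
filterᵇ-∷-cong Q y eq with Q y
... | true  = cong (y ∷_) eq
... | false = eq

filterᵇ-gamBlocks-starters : ∀ (P Q : ℕ → Bool) a ys → (∀ y → Q y ≡ true → P y ≡ true) →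
                             filterᵇ Q (gamBlocks P a ys) ≡ filterᵇ Q (a ∷ ys)
filterᵇ-gamBlocks-starters P Q a [] Q⇒P = refl
filterᵇ-gamBlocks-starters P Q a (y ∷ ys) Q⇒P with P y in py
... | true  = filterᵇ-∷-cong Q a (filterᵇ-gamBlocks-starters P Q y ys Q⇒P)
... | false = begin
    filterᵇ Q (y ∷ gamBlocks P a ys)  ≡⟨ filterᵇ-reject Q _ qy ⟩
    filterᵇ Q (gamBlocks P a ys)      ≡⟨ filterᵇ-gamBlocks-starters P Q a ys Q⇒P ⟩
    filterᵇ Q (a ∷ ys)                ≡⟨ filterᵇ-∷-cong Q a (sym (filterᵇ-reject Q ys qy)) ⟩
    filterᵇ Q (a ∷ y ∷ ys)            ∎
  where
  open ≡-Reasoning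
  qy : Q y ≡ false
  qy with Q y in eq
  ... | true  = ⊥-elim (true≢false (trans (sym (Q⇒P y eq)) py))
  ... | false = refl

filterᵇ-gamBlocks-others : ∀ (P Q : ℕ → Bool) a ys → Q a ≡ false →
                           (∀ y → P y ≡ true → Q y ≡ false) →
                           filterᵇ Q (gamBlocks P a ys) ≡ filterᵇ Q (a ∷ ys)
filterᵇ-gamBlocks-others P Q a [] qa P⇒¬Q = refl
filterᵇ-gamBlocks-others P Q a (y ∷ ys) qa P⇒¬Q with P y in py
... | true  = filterᵇ-∷-cong Q a (filterᵇ-gamBlocks-others P Q y ys (P⇒¬Q y py) P⇒¬Q)
... | false = begin
    filterᵇ Q (y ∷ gamBlocks P a ys)  ≡⟨ filterᵇ-∷-cong Q y
                                           (trans (filterᵇ-gamBlocks-others P Q a ys qa P⇒¬Q)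
                                                  (filterᵇ-reject Q ys qa)) ⟩
    filterᵇ Q (y ∷ ys)                ≡⟨ sym (filterᵇ-reject Q (y ∷ ys) qa) ⟩
    filterᵇ Q (a ∷ y ∷ ys)            ∎
  where open ≡-Reasoning

SameSide : ℕ → ℕ → ℕ → Set
SameSide x a b = (a < x × b < x) ⊎ (x < a × x < b)

γ-before : ∀ {a b} x V → SameSide x a b → before a b (γ x V) ≡ before a b V
γ-before x [] _ = refl
γ-before x (v ∷ vs) s with v <ᵇ x in ev | s
... | true  | inj₁ (a<x , b<x) = before-filterᵇ-cong (_<ᵇ x) (gamBlocks (_<ᵇ x) v vs) (v ∷ vs)
  (<ᵇ-true a<x) (<ᵇ-true b<x) (filterᵇ-gamBlocks-starters (_<ᵇ x) (_<ᵇ x) v vs (λ _ q → q))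
... | true  | inj₂ (x<a , x<b) = before-filterᵇ-cong (x <ᵇ_) (gamBlocks (_<ᵇ x) v vs) (v ∷ vs)
  (<ᵇ-true x<a) (<ᵇ-true x<b)
  (filterᵇ-gamBlocks-others (_<ᵇ x) (x <ᵇ_) v vs (<ᵇ-asym {v} ev) (λ y → <ᵇ-asym {y}))
... | false | inj₁ (a<x , b<x) = before-filterᵇ-cong (_<ᵇ x) (gamBlocks (x <ᵇ_) v vs) (v ∷ vs)
  (<ᵇ-true a<x) (<ᵇ-true b<x) (filterᵇ-gamBlocks-others (x <ᵇ_) (_<ᵇ x) v vs ev (λ y → <ᵇ-asym {x} {y}))
... | false | inj₂ (x<a , x<b) = before-filterᵇ-cong (x <ᵇ_) (gamBlocks (x <ᵇ_) v vs) (v ∷ vs)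
  (<ᵇ-true x<a) (<ᵇ-true x<b) (filterᵇ-gamBlocks-starters (x <ᵇ_) (x <ᵇ_) v vs (λ _ q → q))

compareᵇ : ℕ → ℕ → Bool × Bool
compareᵇ a b = (a <ᵇ b) , (b <ᵇ a)

PreservesSides : (ℕ → ℕ) → ℕ → List ℕ → Set
PreservesSides g x V = ∀ {z} → z ∈ V → compareᵇ (g z) (g x) ≡ compareᵇ z x

gamBlocks-map : ∀ (P P′ : ℕ → Bool) g a ys → (∀ {z} → z ∈ ys → P′ (g z) ≡ P z) →
                gamBlocks P′ (g a) (map g ys) ≡ map g (gamBlocks P a ys)
gamBlocks-map P P′ g a [] _ = refl
gamBlocks-map P P′ g a (y ∷ ys) h rewrite h (here refl) with P y
... | true  = cong (g a ∷_) (gamBlocks-map P P′ g y ys (h ∘ there))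
... | false = cong (g y ∷_) (gamBlocks-map P P′ g a ys (h ∘ there))

γ-map : ∀ g x V → PreservesSides g x V → γ (g x) (map g V) ≡ map g (γ x V)
γ-map g x [] _ = refl
γ-map g x (v ∷ vs) h rewrite cong proj₁ (h (here refl)) with v <ᵇ x
... | true  = gamBlocks-map _ _ g v vs (cong proj₁ ∘ h ∘ there)
... | false = gamBlocks-map _ _ g v vs (cong proj₂ ∘ h ∘ there)

φ-split : ∀ A x V → φ (suc (length A)) (A ++ x ∷ V) ≡ A ++ x ∷ γ x V
φ-split []      x V = refl
φ-split (a ∷ A) x V = cong (a ∷_) (φ-split A x V)

φ-map : ∀ g A x V → PreservesSides g x V →
        φ (suc (length A)) (map g (A ++ x ∷ V)) ≡ map g (φ (suc (length A)) (A ++ x ∷ V))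
φ-map g A x V h = begin
  φ (suc (length A)) (map g (A ++ x ∷ V))          ≡⟨ cong (φ (suc (length A))) (map-++ g A (x ∷ V)) ⟩
  φ (suc (length A)) (map g A ++ g x ∷ map g V)    ≡⟨ cong (λ l → φ (suc l) (map g A ++ g x ∷ map g V))
                                                            (sym (length-map g A)) ⟩
  φ (suc (length (map g A))) (map g A ++ g x ∷ map g V) ≡⟨ φ-split (map g A) (g x) (map g V) ⟩
  map g A ++ g x ∷ γ (g x) (map g V)               ≡⟨ cong (λ t → map g A ++ g x ∷ t) (γ-map g x V h) ⟩
  map g A ++ g x ∷ map g (γ x V)                   ≡⟨ sym (map-++ g A (x ∷ γ x V)) ⟩
  map g (A ++ x ∷ γ x V)                           ≡⟨ cong (map g) (sym (φ-split A x V)) ⟩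
  map g (φ (suc (length A)) (A ++ x ∷ V))          ∎
  where open ≡-Reasoning

-- Cells of the hooks (a , 1^b)

nthD-++ˡ : ∀ {X : Set} (d : X) xs ys {j} → j < length xs → nthD d (xs ++ ys) j ≡ nthD d xs j
nthD-++ˡ d (x ∷ xs) ys {zero}  _         = refl
nthD-++ˡ d (x ∷ xs) ys {suc j} (s≤s j<l) = nthD-++ˡ d xs ys j<l

nthD-++ʳ : ∀ {X : Set} (d : X) xs ys j → nthD d (xs ++ ys) (length xs + j) ≡ nthD d ys j
nthD-++ʳ d []       ys j = refl
nthD-++ʳ d (x ∷ xs) ys j = nthD-++ʳ d xs ys j

nthD-map-applyUpTo : ∀ {X : Set} (d : X) (f : ℕ → X) h a c → c < a →
                     nthD d (map f (applyUpTo h a)) c ≡ f (h c)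
nthD-map-applyUpTo d f h (suc a) zero    _         = refl
nthD-map-applyUpTo d f h (suc a) (suc c) (s≤s c<a) = nthD-map-applyUpTo d f (h ∘ suc) a c c<a

nthD-map-applyUpTo-beyond : ∀ {X : Set} (d : X) (f : ℕ → X) h a c → a ≤ c →
                            nthD d (map f (applyUpTo h a)) c ≡ d
nthD-map-applyUpTo-beyond d f h zero    c       _         = refl
nthD-map-applyUpTo-beyond d f h (suc a) (suc c) (s≤s a≤c) = nthD-map-applyUpTo-beyond d f (h ∘ suc) a c a≤c

length-column : ∀ r b → length (cellsFrom r (replicate b 1)) ≡ b
length-column r zero    = refl
length-column r (suc b) = trans (length-++ (cellsFrom (suc r) (replicate b 1)))
                                (trans (cong (_+ 1) (length-column (suc r) b)) (+-comm b 1))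

nthD-column : ∀ r b p → p < b → nthD (0 , 0) (cellsFrom r (replicate b 1)) p ≡ (r + (b ∸ suc p) , 1)
nthD-column r (suc b) p (s≤s p≤b) with m≤n⇒m<n∨m≡n p≤b
... | inj₁ p<b = begin
  nthD (0 , 0) (cellsFrom (suc r) (replicate b 1) ++ rowCells r 1) p
    ≡⟨ nthD-++ˡ (0 , 0) (cellsFrom (suc r) (replicate b 1)) _ (subst (p <_) (sym (length-column _ b)) p<b) ⟩
  nthD (0 , 0) (cellsFrom (suc r) (replicate b 1)) p
    ≡⟨ nthD-column (suc r) b p p<b ⟩
  (suc r + (b ∸ suc p) , 1)
    ≡⟨ cong (_, 1) (trans (sym (+-suc r (b ∸ suc p))) (cong (r +_) (sym (+-∸-assoc 1 p<b)))) ⟩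
  (r + (b ∸ p) , 1) ∎
  where open ≡-Reasoning
... | inj₂ refl = begin
  nthD (0 , 0) (cellsFrom (suc r) (replicate p 1) ++ rowCells r 1) p
    ≡⟨ cong (nthD (0 , 0) (cellsFrom (suc r) (replicate p 1) ++ rowCells r 1))
            (sym (trans (+-identityʳ _) (length-column (suc r) p))) ⟩
  nthD (0 , 0) (cellsFrom (suc r) (replicate p 1) ++ rowCells r 1) (length (cellsFrom (suc r) (replicate p 1)) + 0)
    ≡⟨ nthD-++ʳ (0 , 0) (cellsFrom (suc r) (replicate p 1)) _ 0 ⟩
  (r , 1)
    ≡⟨ cong (_, 1) (sym (trans (cong (r +_) (n∸n≡0 p)) (+-identityʳ r))) ⟩
  (r + (p ∸ p) , 1) ∎
  where open ≡-Reasoning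

hook-column : ∀ a b p → p < b → cellAt (hook a b) p ≡ (suc (suc (b ∸ suc p)) , 1)
hook-column a b p p<b =
  trans (nthD-++ˡ (0 , 0) (cellsFrom 2 (replicate b 1)) (rowCells 1 a) (subst (p <_) (sym (length-column 2 b)) p<b))
        (nthD-column 2 b p p<b)

hook-bottom : ∀ a b c → cellAt (hook a b) (b + c) ≡ nthD (0 , 0) (rowCells 1 a) c
hook-bottom a b c =
  trans (cong (λ l → nthD (0 , 0) (cells (hook a b)) (l + c)) (sym (length-column 2 b)))
        (nthD-++ʳ (0 , 0) (cellsFrom 2 (replicate b 1)) (rowCells 1 a) c)

∸≡suc[∸suc] : ∀ {p b} → p < b → b ∸ p ≡ suc (b ∸ suc p)
∸≡suc[∸suc] = +-∸-assoc 1

hook-row : ∀ a b c → c < a → cellAt (hook a b) (b + c) ≡ (1 , suc c)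
hook-row a b c c<a = trans (hook-bottom a b c) (nthD-map-applyUpTo (0 , 0) (λ c → (1 , suc c)) (λ c → c) a c c<a)

hook-beyond : ∀ a b c → a ≤ c → cellAt (hook a b) (b + c) ≡ (0 , 0)
hook-beyond a b c a≤c =
  trans (hook-bottom a b c) (nthD-map-applyUpTo-beyond (0 , 0) (λ c → (1 , suc c)) (λ c → c) a c a≤c)

-- (0 , 0) is the default value of nthD: the position lies beyond the filling.
hook-bottom-cell : ∀ a b q → b ≤ q → cellAt (hook a b) q ≡ (1 , suc (q ∸ b)) ⊎ cellAt (hook a b) q ≡ (0 , 0)
hook-bottom-cell a b q b≤q with q ∸ b <? a
... | yes c<a = inj₁ (subst (λ q′ → cellAt (hook a b) q′ ≡ (1 , suc (q ∸ b))) (m+[n∸m]≡n b≤q)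
                          (hook-row a b (q ∸ b) c<a))
... | no  c≮a = inj₂ (subst (λ q′ → cellAt (hook a b) q′ ≡ (0 , 0)) (m+[n∸m]≡n b≤q)
                          (hook-beyond a b (q ∸ b) (≮⇒≥ c≮a)))

attacks-sym : ∀ μ p q → attacks μ p q ≡ attacks μ q p
attacks-sym μ p q with <-cmp p q
... | tri< p<q _ _ rewrite <ᵇ-true p<q | <ᵇ-false (<⇒≤ p<q) = refl
... | tri≈ _ refl _ = refl
... | tri> _ _ q<p rewrite <ᵇ-true q<p | <ᵇ-false (<⇒≤ q<p) = refl

column-cells : ∀ a a′ k p → 0 < a′ → p ≤ k →
               Σ ℕ λ r → cellAt (hook a (suc k)) p ≡ (suc r , 1) × cellAt (hook a′ k) p ≡ (r , 1)
column-cells a a′ k p 0<a′ p≤k with m≤n⇒m<n∨m≡n p≤k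
... | inj₁ p<k  = suc (k ∸ p) , hook-column a (suc k) p (s≤s p≤k) ,
                  trans (hook-column a′ k p p<k) (cong (λ t → (suc t , 1)) (sym (∸≡suc[∸suc] p<k)))
... | inj₂ refl = suc (p ∸ p) , hook-column a (suc p) p (s≤s p≤k) ,
                  trans (cong (cellAt (hook a′ p)) (sym (+-identityʳ p)))
                        (trans (hook-row a′ p 0 0<a′) (cong (λ t → (suc t , 1)) (sym (n∸n≡0 p))))

-- Raising every row by one changes no potential descent or inversion.
attacks-column : ∀ a a′ k p q → 0 < a′ → p ≤ k → q ≤ k →
                 attacks (hook a (suc k)) p q ≡ attacks (hook a′ k) p q
attacks-column a a′ k p q 0<a′ p≤k q≤k
  with column-cells a a′ k p 0<a′ p≤k | column-cells a a′ k q 0<a′ q≤k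
... | _ , μp , νp | _ , μq , νq rewrite μp | νp | μq | νq = refl

attacks-bottom-< : ∀ a b c₁ c₂ → c₁ < c₂ → attacks (hook a b) (b + c₁) (b + c₂) ≡ true
attacks-bottom-< a b c₁ c₂ c₁<c₂ rewrite <ᵇ-true (+-monoʳ-< b c₁<c₂) with c₂ <? a
... | yes c₂<a rewrite hook-row a b c₁ (<-trans c₁<c₂ c₂<a) | hook-row a b c₂ c₂<a = refl
... | no c₂≮a rewrite hook-beyond a b c₂ (≮⇒≥ c₂≮a) with c₁ <? a
...   | yes c₁<a rewrite hook-row a b c₁ c₁<a = refl
...   | no c₁≮a rewrite hook-beyond a b c₁ (≮⇒≥ c₁≮a) = refl

attacks-bottom-ordered : ∀ a b p q → b ≤ p → p < q → attacks (hook a b) p q ≡ true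
attacks-bottom-ordered a b p q b≤p p<q =
  subst₂ (λ p′ q′ → attacks (hook a b) p′ q′ ≡ true)
         (m+[n∸m]≡n b≤p) (m+[n∸m]≡n (≤-trans b≤p (<⇒≤ p<q)))
         (attacks-bottom-< a b (p ∸ b) (q ∸ b) (∸-monoˡ-< p<q b≤p))

attacks-bottom : ∀ a b p q → b ≤ p → b ≤ q → p ≢ q → attacks (hook a b) p q ≡ true
attacks-bottom a b p q b≤p b≤q p≢q with <-cmp p q
... | tri< p<q _ _ = attacks-bottom-ordered a b p q b≤p p<q
... | tri≈ _ p≡q _ = ⊥-elim (p≢q p≡q)
... | tri> _ _ q<p = trans (attacks-sym (hook a b) p q) (attacks-bottom-ordered a b q p b≤q q<p)

attacks-column-bottom-far : ∀ a b p q → suc p < b → b ≤ q → attacks (hook a b) p q ≡ false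
attacks-column-bottom-far a b p q p+1<b b≤q
  rewrite <ᵇ-true (<-≤-trans (<-trans (n<1+n p) p+1<b) b≤q)
        | hook-column a b p (<-trans (n<1+n p) p+1<b) | ∸≡suc[∸suc] p+1<b
  with hook-bottom-cell a b q b≤q
... | inj₁ eq rewrite eq = refl
... | inj₂ eq rewrite eq = refl

attacks-column-bottom-right : ∀ a b p q → p < b → b < q → attacks (hook a b) p q ≡ false
attacks-column-bottom-right a b p q p<b b<q
  rewrite <ᵇ-true (<-trans p<b b<q) | hook-column a b p p<b
  with hook-bottom-cell a b q (<⇒≤ b<q)
... | inj₂ eq rewrite eq = refl
... | inj₁ eq rewrite eq | ∸≡suc[∸suc] b<q with b ∸ suc p
...   | zero  = refl
...   | suc _ = refl

-- Where a letter of A ++ x ∷ V sits, before and after γ acts on V (k = length A).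
data Shift (k : ℕ) : ℕ → ℕ → Set where
  early : ∀ {p} → p < k → Shift k p p
  at    : Shift k k k
  late  : ∀ {p q} → k < p → k < q → Shift k p q

attacks-shift : ∀ a a′ k {p p′ q q′} → 0 < a′ → Shift k p p′ → Shift k q q′ →
                p ≢ q → p′ ≢ q′ →
                (p ≡ k → q ≤ k) → (q ≡ k → p ≤ k) →
                attacks (hook a (suc k)) p q ≡ attacks (hook a′ k) p′ q′
attacks-shift a a′ k 0<a′ (early p<k) (early q<k) _ _ _ _ =
  attacks-column a a′ k _ _ 0<a′ (<⇒≤ p<k) (<⇒≤ q<k)
attacks-shift a a′ k 0<a′ (early p<k) at          _ _ _ _ = attacks-column a a′ k _ _ 0<a′ (<⇒≤ p<k) ≤-refl
attacks-shift a a′ k 0<a′ at          (early q<k) _ _ _ _ = attacks-column a a′ k _ _ 0<a′ ≤-refl (<⇒≤ q<k)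
attacks-shift a a′ k 0<a′ at          at          p≢q _ _ _ = ⊥-elim (p≢q refl)
attacks-shift a a′ k 0<a′ at          (late k<q _) _ _ h _ = ⊥-elim (<⇒≱ k<q (h refl))
attacks-shift a a′ k 0<a′ (late k<p _) at          _ _ _ h = ⊥-elim (<⇒≱ k<p (h refl))
attacks-shift a a′ k {p} {_} {q} {q′} 0<a′ (early p<k) (late k<q k<q′) _ _ _ _ =
  trans (attacks-column-bottom-far a (suc k) p q (s≤s p<k) k<q)
        (sym (attacks-column-bottom-right a′ k p q′ p<k k<q′))
attacks-shift a a′ k {p} {p′} {q} 0<a′ (late k<p k<p′) (early q<k) _ _ _ _ =
  trans (attacks-sym (hook a (suc k)) p q)
        (trans (attacks-column-bottom-far a (suc k) q p (s≤s q<k) k<p)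
               (sym (trans (attacks-sym (hook a′ k) p′ q) (attacks-column-bottom-right a′ k q p′ q<k k<p′))))
attacks-shift a a′ k 0<a′ (late k<p k<p′) (late k<q k<q′) p≢q p′≢q′ _ _ =
  trans (attacks-bottom a (suc k) _ _ k<p k<q p≢q)
        (sym (attacks-bottom a′ k _ _ (<⇒≤ k<p′) (<⇒≤ k<q′) p′≢q′))

pos-++-∈ : ∀ {a} P W W′ → a ∈ P → pos a (P ++ W) ≡ pos a (P ++ W′) × pos a (P ++ W) < length P
pos-++-∈ {a} (q ∷ P) W W′ a∈ with a ≡ᵇ q in eq
... | true  = refl , s≤s z≤n
... | false = let e , lt = pos-++-∈ P W W′ (∈-tail a∈ eq) in cong suc e , s≤s lt

pos-++-∉ : ∀ {a} P W → a ∉ P → pos a (P ++ W) ≡ length P + pos a W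
pos-++-∉ []      W a∉ = refl
pos-++-∉ {a} (q ∷ P) W a∉ rewrite ≡ᵇ-false {a} {q} (a∉ ∘ here) = cong suc (pos-++-∉ P W (a∉ ∘ there))

lookup-pos : ∀ {a} w → a ∈ w → nthD 0 w (pos a w) ≡ a
lookup-pos {a} (q ∷ w) a∈ with a ≡ᵇ q in eq
... | true  = sym (≡ᵇ-true⇒≡ eq)
... | false = lookup-pos w (∈-tail a∈ eq)

pos-injective : ∀ {a b} w → a ∈ w → b ∈ w → pos a w ≡ pos b w → a ≡ b
pos-injective w a∈ b∈ eq = trans (sym (lookup-pos w a∈)) (trans (cong (nthD 0 w) eq) (lookup-pos w b∈))

unique-++-∉ : ∀ (P : List ℕ) {W a} → Unique (P ++ W) → a ∈ P → a ∉ W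
unique-++-∉ (b ∷ P) (b∉ ∷ _)  (here refl) a∈W = All.lookup b∉ (∈-++⁺ʳ P a∈W) refl
unique-++-∉ (b ∷ P) (_  ∷ uq) (there a∈P)     = unique-++-∉ P uq a∈P

pos-at-length : ∀ {s} A x V → s ∈ A ++ x ∷ V → pos s (A ++ x ∷ V) ≡ length A → s ≡ x
pos-at-length {s} A x V s∈ eq = begin
  s                                   ≡⟨ sym (lookup-pos (A ++ x ∷ V) s∈) ⟩
  nthD 0 (A ++ x ∷ V) (pos s (A ++ x ∷ V)) ≡⟨ cong (nthD 0 (A ++ x ∷ V)) (trans eq (sym (+-identityʳ _))) ⟩
  nthD 0 (A ++ x ∷ V) (length A + 0)  ≡⟨ nthD-++ʳ 0 A (x ∷ V) 0 ⟩
  x                                   ∎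
  where open ≡-Reasoning

shift-φ : ∀ s A x V → Shift (length A) (pos s (A ++ x ∷ V)) (pos s (A ++ x ∷ γ x V))
shift-φ s A x V with s ∈? A
... | yes s∈A = let e , lt = pos-++-∈ A (x ∷ V) (x ∷ γ x V) s∈A in subst (Shift (length A) _) e (early lt)
... | no  s∉A rewrite pos-++-∉ A (x ∷ V) s∉A | pos-++-∉ A (x ∷ γ x V) s∉A with s ≡ᵇ x in eq
...   | true  rewrite +-identityʳ (length A) = at
...   | false = late (m<m+n (length A) (s≤s z≤n)) (m<m+n (length A) (s≤s z≤n))

before-φ : ∀ {a b} A x V → (a ∈ A ++ x ∷ [] ⊎ b ∈ A ++ x ∷ []) ⊎ SameSide x a b →
           before a b (A ++ x ∷ γ x V) ≡ before a b (A ++ x ∷ V)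
before-φ {a} {b} A x V h = begin
  before a b (A ++ x ∷ γ x V)          ≡⟨ cong (before a b) (sym (++-assoc A (x ∷ []) (γ x V))) ⟩
  before a b ((A ++ x ∷ []) ++ γ x V)  ≡⟨ before-++ (A ++ x ∷ []) (Sum.map₂ (γ-before x V) h) ⟩
  before a b ((A ++ x ∷ []) ++ V)      ≡⟨ cong (before a b) (++-assoc A (x ∷ []) V) ⟩
  before a b (A ++ x ∷ V)              ∎
  where open ≡-Reasoning

-- D as a substitution of letters

-- The renaming done by d_i (attack false) or d̃_i (attack true) with i = suc m, given the
-- farther neighbour f and whether i - 1 precedes i + 1 and i precedes i - 1; cf. dt.
relabel : ℕ → Bool → ℕ → Bool → Bool → ℕ → ℕ
relabel m false f _          _          = swapL (suc m) f
relabel m true  _ m-before-p i-before-m =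
  if i-before-m then cyc (suc m) lo hi else cyc lo (suc m) hi
  where
  lo hi : ℕ
  lo = if m-before-p then m else suc (suc m)
  hi = if m-before-p then suc (suc m) else m

D-substitution : List ℕ → ℕ → List ℕ → ℕ → ℕ
D-substitution μ m w =
  relabel m (attacks μ (pos (suc m) w) (pos (farther (suc m) w) w)) (farther (suc m) w)
            (before m (suc (suc m)) w) (before (suc m) m w)

D-as-map : ∀ μ m w → between (suc m) w ≡ false → D μ (suc m) w ≡ map (D-substitution μ m w) w
D-as-map μ m w nb rewrite nb with attacks μ (pos (suc m) w) (pos (farther (suc m) w) w)
... | false = refl
... | true with pos (suc m) w <ᵇ pos m w
...   | true  = refl
...   | false = refl

D-between : ∀ μ m w → between (suc m) w ≡ true → D μ (suc m) w ≡ w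
D-between μ m w b rewrite b = refl

triple : ℕ → List ℕ
triple m = m ∷ suc m ∷ suc (suc m) ∷ []

pattern lowest  = here refl
pattern centre  = there (here refl)
pattern highest = there (there (here refl))

triple-bounds : ∀ {m z} → z ∈ triple m → m ≤ z × z ≤ suc (suc m)
triple-bounds {m} lowest  = ≤-refl , m≤n+m m 2
triple-bounds {m} centre  = n≤1+n m , n≤1+n (suc m)
triple-bounds {m} highest = m≤n+m m 2 , ≤-refl

triple-minus : ∀ {m x} → x ∈ triple m → ∃₂ λ b c → ∀ {s} → s ∈ triple m → s ≢ x → s ≡ b ⊎ s ≡ c
triple-minus lowest  = _ , _ , λ { lowest s≢x → ⊥-elim (s≢x refl) ; centre _ → inj₁ refl
                                 ; highest _ → inj₂ refl ; (there (there (there ()))) _ }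
triple-minus centre  = _ , _ , λ { lowest _ → inj₁ refl ; centre s≢x → ⊥-elim (s≢x refl)
                                 ; highest _ → inj₂ refl ; (there (there (there ()))) _ }
triple-minus highest = _ , _ , λ { lowest _ → inj₁ refl ; centre _ → inj₂ refl
                                 ; highest s≢x → ⊥-elim (s≢x refl) ; (there (there (there ()))) _ }

triple-pigeonhole : ∀ {m x y t s} → x ∈ triple m → y ∈ triple m → t ∈ triple m → y ≢ x → t ≢ x → y ≢ t →
                    s ∈ triple m → s ≢ x → s ≡ y ⊎ s ≡ t
triple-pigeonhole x∈ y∈ t∈ y≢x t≢x y≢t s∈ s≢x with triple-minus x∈
... | _ , _ , others with others s∈ s≢x | others y∈ y≢x | others t∈ t≢x
...   | inj₁ refl | inj₁ refl | _         = inj₁ refl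
...   | inj₁ refl | inj₂ refl | inj₁ refl = inj₂ refl
...   | inj₁ refl | inj₂ refl | inj₂ refl = ⊥-elim (y≢t refl)
...   | inj₂ refl | inj₂ refl | _         = inj₁ refl
...   | inj₂ refl | inj₁ refl | inj₂ refl = inj₂ refl
...   | inj₂ refl | inj₁ refl | inj₁ refl = ⊥-elim (y≢t refl)

sameSide-triple : ∀ {m x a b} → x ≢ suc m → a ∈ triple m → b ∈ triple m → a ≢ x → b ≢ x →
                  SameSide x a b
sameSide-triple {m} {x} x≢i a∈ b∈ a≢x b≢x with <-cmp x (suc m)
... | tri< x<i _ _ = inj₂ (above a∈ a≢x , above b∈ b≢x)
  where
  above : ∀ {s} → s ∈ triple m → s ≢ x → x < s
  above s∈ s≢x = ≤∧≢⇒< (≤-trans (≤-pred x<i) (proj₁ (triple-bounds s∈))) (s≢x ∘ sym)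
... | tri≈ _ x≡i _ = ⊥-elim (x≢i x≡i)
... | tri> _ _ i<x = inj₁ (below a∈ a≢x , below b∈ b≢x)
  where
  below : ∀ {s} → s ∈ triple m → s ≢ x → s < x
  below s∈ s≢x = ≤∧≢⇒< (≤-trans (proj₂ (triple-bounds s∈)) i<x) s≢x

sameSide-outside : ∀ {m x a b} → x ∉ triple m → a ∈ triple m → b ∈ triple m → SameSide x a b
sameSide-outside x∉ a∈ b∈ =
  sameSide-triple (∉⇒≢ x∉ centre) a∈ b∈ (≢-sym (∉⇒≢ x∉ a∈)) (≢-sym (∉⇒≢ x∉ b∈))

compareᵇ-sameSide : ∀ {x a b} → SameSide x a b → compareᵇ a x ≡ compareᵇ b x
compareᵇ-sameSide (inj₁ (a<x , b<x))
  rewrite <ᵇ-true a<x | <ᵇ-true b<x | <ᵇ-false (<⇒≤ a<x) | <ᵇ-false (<⇒≤ b<x) = refl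
compareᵇ-sameSide (inj₂ (x<a , x<b))
  rewrite <ᵇ-true x<a | <ᵇ-true x<b | <ᵇ-false (<⇒≤ x<a) | <ᵇ-false (<⇒≤ x<b) = refl

if-∈ : ∀ {L : List ℕ} {a b} c → a ∈ L → b ∈ L → (if c then a else b) ∈ L
if-∈ true  a∈ _  = a∈
if-∈ false _  b∈ = b∈

swapL-∈ : ∀ {L : List ℕ} a b z → a ∈ L → b ∈ L → z ∈ L → swapL a b z ∈ L
swapL-∈ a b z a∈ b∈ z∈ with z ≡ᵇ a
... | true = b∈
... | false with z ≡ᵇ b
...   | true  = a∈
...   | false = z∈

cyc-∈ : ∀ {L : List ℕ} a b c z → a ∈ L → b ∈ L → c ∈ L → z ∈ L → cyc a b c z ∈ L
cyc-∈ a b c z a∈ b∈ c∈ z∈ with z ≡ᵇ a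
... | true = b∈
... | false with z ≡ᵇ b
...   | true = c∈
...   | false with z ≡ᵇ c
...     | true  = a∈
...     | false = z∈

swapL-fix : ∀ {L : List ℕ} a b z → a ∈ L → b ∈ L → z ∉ L → swapL a b z ≡ z
swapL-fix a b z a∈ b∈ z∉ rewrite ≡ᵇ-false (∉⇒≢ z∉ a∈) | ≡ᵇ-false (∉⇒≢ z∉ b∈) = refl

cyc-fix : ∀ {L : List ℕ} a b c z → a ∈ L → b ∈ L → c ∈ L → z ∉ L → cyc a b c z ≡ z
cyc-fix a b c z a∈ b∈ c∈ z∉
  rewrite ≡ᵇ-false (∉⇒≢ z∉ a∈) | ≡ᵇ-false (∉⇒≢ z∉ b∈) | ≡ᵇ-false (∉⇒≢ z∉ c∈) = refl

relabel-∈ : ∀ m att f c₁ c₂ z → f ∈ triple m → z ∈ triple m → relabel m att f c₁ c₂ z ∈ triple m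
relabel-∈ m false f c₁ c₂ z f∈ z∈ = swapL-∈ (suc m) f z centre f∈ z∈
relabel-∈ m true  f c₁ true  z f∈ z∈ =
  cyc-∈ _ _ _ z centre (if-∈ c₁ lowest highest) (if-∈ c₁ highest lowest) z∈
relabel-∈ m true  f c₁ false z f∈ z∈ =
  cyc-∈ _ _ _ z (if-∈ c₁ lowest highest) centre (if-∈ c₁ highest lowest) z∈

relabel-fix : ∀ m att f c₁ c₂ z → f ∈ triple m → z ∉ triple m → relabel m att f c₁ c₂ z ≡ z
relabel-fix m false f c₁ c₂ z f∈ z∉ = swapL-fix (suc m) f z centre f∈ z∉
relabel-fix m true  f c₁ true  z f∈ z∉ =
  cyc-fix _ _ _ z centre (if-∈ c₁ lowest highest) (if-∈ c₁ highest lowest) z∉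
relabel-fix m true  f c₁ false z f∈ z∉ =
  cyc-fix _ _ _ z (if-∈ c₁ lowest highest) centre (if-∈ c₁ highest lowest) z∉

relabel-preservesSides : ∀ m att f c₁ c₂ {x z} → f ∈ triple m → x ∉ triple m ⊎ z ∉ triple m →
                         compareᵇ (relabel m att f c₁ c₂ z) (relabel m att f c₁ c₂ x) ≡ compareᵇ z x
relabel-preservesSides m att f c₁ c₂ {x} {z} f∈ outside with x ∈? triple m | z ∈? triple m
... | no x∉ | no z∉
  rewrite relabel-fix m att f c₁ c₂ x f∈ x∉ | relabel-fix m att f c₁ c₂ z f∈ z∉ = refl
... | no x∉ | yes z∈ rewrite relabel-fix m att f c₁ c₂ x f∈ x∉ =
  compareᵇ-sameSide (sameSide-outside x∉ (relabel-∈ m att f c₁ c₂ z f∈ z∈) z∈)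
... | yes x∈ | no z∉ rewrite relabel-fix m att f c₁ c₂ z f∈ z∉ =
  cong swap (compareᵇ-sameSide (sameSide-outside z∉ (relabel-∈ m att f c₁ c₂ x f∈ x∈) x∈))
... | yes x∈ | yes z∈ with outside
...   | inj₁ x∉ = ⊥-elim (x∉ x∈)
...   | inj₂ z∉ = ⊥-elim (z∉ z∈)

farther-spec : ∀ m w →
    (farther (suc m) w ≡ suc (suc m) × ∣ pos m w - pos (suc m) w ∣ < ∣ pos (suc (suc m)) w - pos (suc m) w ∣)
  ⊎ (farther (suc m) w ≡ m × ∣ pos (suc (suc m)) w - pos (suc m) w ∣ ≤ ∣ pos m w - pos (suc m) w ∣)
farther-spec m w with ∣ pos m w - pos (suc m) w ∣ <ᵇ ∣ pos (suc (suc m)) w - pos (suc m) w ∣ in eq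
... | true  = inj₁ (refl , <ᵇ⇒< _ _ (Equivalence.from T-≡ eq))
... | false = inj₂ (refl , ≮⇒≥ (λ lt → true≢false (trans (sym (<ᵇ-true lt)) eq)))

farther-∈ : ∀ m w → farther (suc m) w ∈ triple m
farther-∈ m w with farther-spec m w
... | inj₁ (f≡ , _) rewrite f≡ = highest
... | inj₂ (f≡ , _) rewrite f≡ = lowest

farther-≢ : ∀ m w → farther (suc m) w ≢ suc m
farther-≢ m w with farther-spec m w
... | inj₁ (f≡ , _) rewrite f≡ = ≢-sym (<⇒≢ (n<1+n (suc m)))
... | inj₂ (f≡ , _) rewrite f≡ = <⇒≢ (n<1+n m)

neighbour-≢ : ∀ m c → (if c then m else suc (suc m)) ≢ suc m
neighbour-≢ m true  = <⇒≢ (n<1+n m)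
neighbour-≢ m false = ≢-sym (<⇒≢ (n<1+n (suc m)))

relabel-moves-centre : ∀ m att f c₁ c₂ → f ≢ suc m → relabel m att f c₁ c₂ (suc m) ≢ suc m
relabel-moves-centre m false f c₁ c₂ f≢i rewrite ≡ᵇ-refl m = f≢i
relabel-moves-centre m true  f c₁ true  f≢i rewrite ≡ᵇ-refl m = neighbour-≢ m c₁
relabel-moves-centre m true  f true  false f≢i
  rewrite ≡ᵇ-false (≢-sym (neighbour-≢ m true)) | ≡ᵇ-refl m = neighbour-≢ m false
relabel-moves-centre m true  f false false f≢i
  rewrite ≡ᵇ-false (≢-sym (neighbour-≢ m false)) | ≡ᵇ-refl m = neighbour-≢ m true

between-true : ∀ m w →
  (pos m w < pos (suc m) w × pos (suc m) w < pos (suc (suc m)) w) ⊎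
  (pos (suc (suc m)) w < pos (suc m) w × pos (suc m) w < pos m w) → between (suc m) w ≡ true
between-true m w (inj₁ (m<i , i<p)) rewrite <ᵇ-true m<i | <ᵇ-true i<p = refl
between-true m w (inj₂ (p<i , i<m)) rewrite <ᵇ-false (<⇒≤ i<m) | <ᵇ-true p<i | <ᵇ-true i<m = refl

nearer-by-order : ∀ a b c → a ≢ b → b ≢ c → a ≢ c →
  (((a <ᵇ b) ∧ (b <ᵇ c)) ∨ ((c <ᵇ b) ∧ (b <ᵇ a))) ≡ false →
  (∣ a - b ∣ <ᵇ ∣ c - b ∣) ≡ (if a <ᵇ b then c <ᵇ a else a <ᵇ c)
nearer-by-order a b c a≢b b≢c a≢c nb with <-cmp a b | <-cmp b c
... | tri≈ _ a≡b _ | _ = ⊥-elim (a≢b a≡b)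
... | _ | tri≈ _ b≡c _ = ⊥-elim (b≢c b≡c)
... | tri< a<b _ _ | tri< b<c _ _ rewrite <ᵇ-true a<b | <ᵇ-true b<c = ⊥-elim (true≢false nb)
... | tri> _ _ b<a | tri> _ _ c<b
  rewrite <ᵇ-false (<⇒≤ b<a) | <ᵇ-true c<b | <ᵇ-true b<a = ⊥-elim (true≢false nb)
... | tri< a<b _ _ | tri> _ _ c<b
  rewrite <ᵇ-true a<b | m≤n⇒∣m-n∣≡n∸m (<⇒≤ a<b) | m≤n⇒∣m-n∣≡n∸m (<⇒≤ c<b) with <-cmp a c
...   | tri< a<c _ _ rewrite <ᵇ-false {c} {a} (<⇒≤ a<c) = <ᵇ-false (∸-monoʳ-≤ b (<⇒≤ a<c))
...   | tri≈ _ a≡c _ = ⊥-elim (a≢c a≡c)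
...   | tri> _ _ c<a rewrite <ᵇ-true c<a = <ᵇ-true (∸-monoʳ-< c<a (<⇒≤ a<b))
nearer-by-order a b c a≢b b≢c a≢c nb | tri> _ _ b<a | tri< b<c _ _
  rewrite <ᵇ-false (<⇒≤ b<a) | m≤n⇒∣n-m∣≡n∸m (<⇒≤ b<a) | m≤n⇒∣n-m∣≡n∸m (<⇒≤ b<c)
  with <-cmp a c
...   | tri< a<c _ _ rewrite <ᵇ-true a<c = <ᵇ-true (∸-monoˡ-< a<c (<⇒≤ b<a))
...   | tri≈ _ a≡c _ = ⊥-elim (a≢c a≡c)
...   | tri> _ _ c<a rewrite <ᵇ-false (<⇒≤ c<a) = <ᵇ-false (∸-monoˡ-≤ b (<⇒≤ c<a))

D-substitution-preservesSides : ∀ μ m w {x z} → x ∉ triple m ⊎ z ∉ triple m →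
  compareᵇ (D-substitution μ m w z) (D-substitution μ m w x) ≡ compareᵇ z x
D-substitution-preservesSides μ m w =
  relabel-preservesSides m (attacks μ (pos (suc m) w) (pos (farther (suc m) w) w)) (farther (suc m) w)
                         (before m (suc (suc m)) w) (before (suc m) m w) (farther-∈ m w)

D-substitution-moves-centre : ∀ μ m w → D-substitution μ m w (suc m) ≢ suc m
D-substitution-moves-centre μ m w =
  relabel-moves-centre m (attacks μ (pos (suc m) w) (pos (farther (suc m) w) w)) (farther (suc m) w)
                       (before m (suc (suc m)) w) (before (suc m) m w) (farther-≢ m w)

map-fixes : ∀ (g : ℕ → ℕ) {a} w → map g w ≡ w → a ∈ w → g a ≡ a
map-fixes g (b ∷ w) eq (here refl) = proj₁ (∷-injective eq)
map-fixes g (b ∷ w) eq (there a∈) = map-fixes g w (proj₂ (∷-injective eq)) a∈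

distance-between : ∀ {a b c} → a < b → b < c → ∣ b - a ∣ < ∣ c - a ∣ × ∣ b - c ∣ < ∣ a - c ∣
distance-between {a} {b} {c} a<b b<c
  rewrite m≤n⇒∣n-m∣≡n∸m (<⇒≤ a<b) | m≤n⇒∣n-m∣≡n∸m (<⇒≤ (<-trans a<b b<c))
        | m≤n⇒∣m-n∣≡n∸m (<⇒≤ b<c) | m≤n⇒∣m-n∣≡n∸m (<⇒≤ (<-trans a<b b<c))
  = ∸-monoˡ-< b<c (<⇒≤ a<b) , ∸-monoʳ-< a<b (<⇒≤ b<c)

PositionsDistinct : ℕ → List ℕ → Set
PositionsDistinct m w = ∀ {a b} → a ∈ triple m → b ∈ triple m → a ≢ b → pos a w ≢ pos b w

SameOrderOn : ℕ → List ℕ → List ℕ → Set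
SameOrderOn m w w′ = ∀ {a b} → a ∈ triple m → b ∈ triple m → before a b w′ ≡ before a b w

fartherByOrder : ℕ → List ℕ → ℕ
fartherByOrder m w =
  if (if before m (suc m) w then before (suc (suc m)) m w else before m (suc (suc m)) w)
  then suc (suc m) else m

-- γ moves positions, so distances are not preserved, but once i is not between its neighbours
-- the farther one is determined by relative order alone.
farther-by-order : ∀ m w → PositionsDistinct m w → between (suc m) w ≡ false →
                   farther (suc m) w ≡ fartherByOrder m w
farther-by-order m w distinct nb
  rewrite nearer-by-order (pos m w) (pos (suc m) w) (pos (suc (suc m)) w)
            (distinct lowest centre (<⇒≢ (n<1+n m))) (distinct centre highest (<⇒≢ (n<1+n (suc m))))
            (distinct lowest highest (<⇒≢ (m<n+m m {2} (s≤s z≤n)))) nb = refl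

between-cong : ∀ m w w′ → SameOrderOn m w w′ → between (suc m) w′ ≡ between (suc m) w
between-cong m w w′ o = cong₂ _∨_ (cong₂ _∧_ (o lowest centre) (o centre highest))
                           (cong₂ _∧_ (o highest centre) (o centre lowest))

fartherByOrder-cong : ∀ m w w′ → SameOrderOn m w w′ → fartherByOrder m w′ ≡ fartherByOrder m w
fartherByOrder-cong m w w′ o rewrite o lowest centre | o highest lowest | o lowest highest = refl

positionsDistinct : ∀ {m w} → (∀ {s} → s ∈ triple m → s ∈ w) → PositionsDistinct m w
positionsDistinct {w = w} ⊆w a∈ b∈ a≢b eq = a≢b (pos-injective w (⊆w a∈) (⊆w b∈) eq)

before-true⇒≢ : ∀ {a b} w → before a b w ≡ true → pos a w ≢ pos b w
before-true⇒≢ {b = b} w bt eq =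
  true≢false (trans (sym bt) (trans (cong (_<ᵇ pos b w) eq) (<ᵇ-false {pos b w} ≤-refl)))

positionsDistinct-transfer : ∀ m w w′ → SameOrderOn m w w′ → PositionsDistinct m w → PositionsDistinct m w′
positionsDistinct-transfer m w w′ o distinct {a} {b} a∈ b∈ a≢b with <-cmp (pos a w) (pos b w)
... | tri< lt _ _ = before-true⇒≢ w′ (trans (o a∈ b∈) (<ᵇ-true lt))
... | tri≈ _ eq _ = ⊥-elim (distinct a∈ b∈ a≢b eq)
... | tri> _ _ gt = ≢-sym (before-true⇒≢ w′ (trans (o b∈ a∈) (<ᵇ-true gt)))

-- φ_k against D_i on u = A ++ x ∷ V, where k = length A + 1 = suc ℓ

module Split (a a′ m : ℕ) (A : List ℕ) (x : ℕ) (V : List ℕ) where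

  ℓ : ℕ
  ℓ = length A

  u u′ : List ℕ
  u  = A ++ x ∷ V
  u′ = A ++ x ∷ γ x V

  μ ν : List ℕ
  μ = hook a (suc ℓ)
  ν = hook a′ ℓ

  i f : ℕ
  i = suc m
  f = farther i u

  Settled : ℕ → Set
  Settled s = s ∈ A ++ x ∷ []

  x-settled : Settled x
  x-settled = ∈-++⁺ʳ A (here refl)

  TripleIn : Set
  TripleIn = ∀ {s} → s ∈ triple m → s ∈ u

  φ-D-commute : between i u ≡ false → PositionsDistinct m u → SameOrderOn m u u′ →
                attacks μ (pos i u) (pos f u) ≡ attacks ν (pos i u′) (pos f u′) →
                PreservesSides (D-substitution μ m u) x V →
                φ (suc ℓ) (D μ i u) ≡ D ν i (φ (suc ℓ) u)
  φ-D-commute nb distinct o att ps = begin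
    φ (suc ℓ) (D μ i u)             ≡⟨ cong (φ (suc ℓ)) (D-as-map μ m u nb) ⟩
    φ (suc ℓ) (map g u)             ≡⟨ φ-map g A x V ps ⟩
    map g (φ (suc ℓ) u)             ≡⟨ cong (map g) (φ-split A x V) ⟩
    map g u′                        ≡⟨ cong (λ h → map h u′) same-substitution ⟩
    map (D-substitution ν m u′) u′  ≡⟨ sym (D-as-map ν m u′ (trans (between-cong m u u′ o) nb)) ⟩
    D ν i u′                        ≡⟨ cong (D ν i) (sym (φ-split A x V)) ⟩
    D ν i (φ (suc ℓ) u)             ∎
    where
    open ≡-Reasoning
    g : ℕ → ℕ
    g = D-substitution μ m u
    same-farther : farther i u′ ≡ f
    same-farther = trans (farther-by-order m u′ (positionsDistinct-transfer m u u′ o distinct)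
                                            (trans (between-cong m u u′ o) nb))
                         (trans (fartherByOrder-cong m u u′ o) (sym (farther-by-order m u distinct nb)))
    same-substitution : g ≡ D-substitution ν m u′
    same-substitution rewrite same-farther | att | o lowest highest | o centre lowest = refl

  sameOrder-settled : (∀ {s} → s ∈ triple m → Settled s) → SameOrderOn m u u′
  sameOrder-settled settled a∈ _ = before-φ A x V (inj₁ (inj₁ (settled a∈)))

  sameOrder-off-centre : x ≢ i → SameOrderOn m u u′
  sameOrder-off-centre x≢i {a} {b} a∈ b∈ with a ≟ x | b ≟ x
  ... | yes refl | _        = before-φ A x V (inj₁ (inj₁ x-settled))
  ... | no _     | yes refl = before-φ A x V (inj₁ (inj₂ x-settled))
  ... | no a≢x   | no b≢x   = before-φ A x V (inj₂ (sameSide-triple x≢i a∈ b∈ a≢x b≢x))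

  -- When x = i, each pair of letters deciding whether i is between its neighbours contains x.
  between-φ : between i u′ ≡ between i u
  between-φ with x ≟ i
  ... | no x≢i  = between-cong m u u′ (sameOrder-off-centre x≢i)
  ... | yes refl = cong₂ _∨_ (cong₂ _∧_ x-second x-first) (cong₂ _∧_ x-second x-first)
    where
    x-first : ∀ {b} → before x b u′ ≡ before x b u
    x-first = before-φ A x V (inj₁ (inj₁ x-settled))
    x-second : ∀ {a} → before a x u′ ≡ before a x u
    x-second = before-φ A x V (inj₁ (inj₂ x-settled))

  pos-settled : ∀ {s} → Settled s → pos s u ≤ ℓ
  pos-settled {s} s∈ =
    ≤-pred (subst₂ _<_ (cong (pos s) (++-assoc A (x ∷ []) V)) (trans (length-++ A) (+-comm ℓ 1))
                       (proj₂ (pos-++-∈ (A ++ x ∷ []) V V s∈)))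

  attacks-φ : 0 < a′ → TripleIn → SameOrderOn m u u′ → (i ≡ x → Settled f) → (f ≡ x → Settled i) →
              attacks μ (pos i u) (pos f u) ≡ attacks ν (pos i u′) (pos f u′)
  attacks-φ 0<a′ ⊆u o i≡x⇒ f≡x⇒ =
    attacks-shift a a′ ℓ 0<a′ (shift-φ i A x V) (shift-φ f A x V) (distinct centre f∈ i≢f)
                  (positionsDistinct-transfer m u u′ o distinct centre f∈ i≢f)
                  (λ p≡ℓ → pos-settled (i≡x⇒ (pos-at-length A x V (⊆u centre) p≡ℓ)))
                  (λ q≡ℓ → pos-settled (f≡x⇒ (pos-at-length A x V (⊆u f∈) q≡ℓ)))
    where
    distinct : PositionsDistinct m u
    distinct = positionsDistinct ⊆u
    f∈ : f ∈ triple m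
    f∈ = farther-∈ m u
    i≢f : i ≢ f
    i≢f = ≢-sym (farther-≢ m u)

  settled-∉V : Unique u → ∀ {s} → Settled s → s ∉ V
  settled-∉V uq = unique-++-∉ (A ++ x ∷ []) (subst Unique (sym (++-assoc A (x ∷ []) V)) uq)

  φ-D-outside : 0 < a′ → TripleIn → x ∉ triple m → between i u ≡ false →
                φ (suc ℓ) (D μ i u) ≡ D ν i (φ (suc ℓ) u)
  φ-D-outside 0<a′ ⊆u x∉ nb =
    φ-D-commute nb (positionsDistinct ⊆u) o
      (attacks-φ 0<a′ ⊆u o (λ i≡x → ⊥-elim (∉⇒≢ x∉ centre (sym i≡x)))
                           (λ f≡x → ⊥-elim (∉⇒≢ x∉ (farther-∈ m u) (sym f≡x))))
      (λ _ → D-substitution-preservesSides μ m u (inj₁ x∉))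
    where
    o : SameOrderOn m u u′
    o = sameOrder-off-centre (∉⇒≢ x∉ centre)

  φ-D-settled : 0 < a′ → Unique u → TripleIn → (∀ {s} → s ∈ triple m → Settled s) →
                between i u ≡ false →
                φ (suc ℓ) (D μ i u) ≡ D ν i (φ (suc ℓ) u)
  φ-D-settled 0<a′ uq ⊆u settled nb =
    φ-D-commute nb (positionsDistinct ⊆u) o
      (attacks-φ 0<a′ ⊆u o (λ _ → settled (farther-∈ m u)) (λ _ → settled centre))
      (λ z∈V → D-substitution-preservesSides μ m u (inj₂ (λ z∈ → settled-∉V uq (settled z∈) z∈V)))
    where
    o : SameOrderOn m u u′
    o = sameOrder-settled settled

  -- The third letter t lies in V, so the positions of y, x, t are < ℓ, = ℓ, > ℓ.
  module Straddling (0<a′ : 0 < a′) (uq : Unique u) (⊆u : TripleIn) (x∈ : x ∈ triple m)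
                    {y t : ℕ} (y∈A : y ∈ A) (y∈ : y ∈ triple m)
                    (t∈ : t ∈ triple m) (t∉ : t ∉ A ++ x ∷ [])
                    (nb : between i u ≡ false) where

    x∉A : x ∉ A
    x∉A x∈A = unique-++-∉ A uq x∈A (here refl)

    y≢x : y ≢ x
    y≢x y≡x = unique-++-∉ A uq y∈A (here y≡x)

    t≢x : t ≢ x
    t≢x t≡x = t∉ (subst Settled (sym t≡x) x-settled)

    y≢t : y ≢ t
    y≢t y≡t = t∉ (∈-++⁺ˡ (subst (_∈ A) y≡t y∈A))

    others : ∀ {s} → s ∈ triple m → s ≢ x → s ≡ y ⊎ s ≡ t
    others = triple-pigeonhole x∈ y∈ t∈ y≢x t≢x y≢t

    x-at : pos x u ≡ ℓ
    x-at rewrite pos-++-∉ A (x ∷ V) x∉A | ≡ᵇ-refl x = +-identityʳ ℓ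

    y-early : pos y u < ℓ
    y-early = proj₂ (pos-++-∈ A (x ∷ V) (x ∷ V) y∈A)

    t-late : ℓ < pos t u
    t-late rewrite pos-++-∉ A (x ∷ V) (t∉ ∘ ∈-++⁺ˡ) | ≡ᵇ-false t≢x = m<m+n ℓ (s≤s z≤n)

    y<x : pos y u < pos x u
    y<x = subst (pos y u <_) (sym x-at) y-early

    x<t : pos x u < pos t u
    x<t = subst (_< pos t u) (sym x-at) t-late

    order : ∀ {b s c} → b ≡ y → s ≡ x → c ≡ t → pos b u < pos s u × pos s u < pos c u
    order refl refl refl = y<x , x<t

    closer : ∀ {s o} → s ≡ y ⊎ s ≡ t → o ≡ y ⊎ o ≡ t → s ≢ o →
             ∣ pos x u - pos s u ∣ < ∣ pos o u - pos s u ∣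
    closer (inj₁ refl) (inj₂ refl) _   = proj₁ (distance-between y<x x<t)
    closer (inj₂ refl) (inj₁ refl) _   = proj₂ (distance-between y<x x<t)
    closer (inj₁ refl) (inj₁ refl) s≢o = ⊥-elim (s≢o refl)
    closer (inj₂ refl) (inj₂ refl) s≢o = ⊥-elim (s≢o refl)

    m≢i : m ≢ i
    m≢i = <⇒≢ (n<1+n m)

    i≢p : i ≢ suc (suc m)
    i≢p = <⇒≢ (n<1+n (suc m))

    m≢p : m ≢ suc (suc m)
    m≢p = <⇒≢ (m<n+m m {2} (s≤s z≤n))

    centre-≢-x : i ≢ x
    centre-≢-x i≡x with others lowest (λ m≡x → m≢i (trans m≡x (sym i≡x)))
                      | others highest (λ p≡x → i≢p (trans i≡x (sym p≡x)))
    ... | inj₁ m≡y | inj₁ p≡y = m≢p (trans m≡y (sym p≡y))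
    ... | inj₂ m≡t | inj₂ p≡t = m≢p (trans m≡t (sym p≡t))
    ... | inj₁ m≡y | inj₂ p≡t = true≢false (trans (sym (between-true m u (inj₁ (order m≡y i≡x p≡t)))) nb)
    ... | inj₂ m≡t | inj₁ p≡y = true≢false (trans (sym (between-true m u (inj₂ (order p≡y i≡x m≡t)))) nb)

    i-side : i ≡ y ⊎ i ≡ t
    i-side = others centre centre-≢-x

    dist : ℕ → ℕ
    dist s = ∣ pos s u - pos i u ∣

    farther-≢-x : f ≢ x
    farther-≢-x f≡x with farther-spec m u
    ... | inj₁ (f≡p , m-nearer) = <-asym m-nearer (subst (λ s → dist s < dist m) x≡p x-nearer)
      where
      x≡p : x ≡ suc (suc m)
      x≡p = trans (sym f≡x) f≡p
      x-nearer : dist x < dist m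
      x-nearer = closer i-side (others lowest (λ m≡x → m≢p (trans m≡x x≡p))) (≢-sym m≢i)
    ... | inj₂ (f≡m , p-nearer) = <⇒≱ (subst (λ s → dist s < dist (suc (suc m))) x≡m x-nearer) p-nearer
      where
      x≡m : x ≡ m
      x≡m = trans (sym f≡x) f≡m
      x-nearer : dist x < dist (suc (suc m))
      x-nearer = closer i-side (others highest (λ p≡x → m≢p (trans (sym x≡m) (sym p≡x)))) i≢p

    f-side : f ≡ y ⊎ f ≡ t
    f-side = others (farther-∈ m u) farther-≢-x

    no-attack : attacks μ (pos i u) (pos f u) ≡ false
    no-attack = apart i-side f-side (≢-sym (farther-≢ m u))
      where
      apart : ∀ {s o} → s ≡ y ⊎ s ≡ t → o ≡ y ⊎ o ≡ t → s ≢ o →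
              attacks μ (pos s u) (pos o u) ≡ false
      apart (inj₁ refl) (inj₂ refl) _ = attacks-column-bottom-far a (suc ℓ) _ _ (s≤s y-early) t-late
      apart (inj₂ refl) (inj₁ refl) _ = trans (attacks-sym μ _ _) (apart (inj₁ refl) (inj₂ refl) y≢t)
      apart (inj₁ refl) (inj₁ refl) s≢o = ⊥-elim (s≢o refl)
      apart (inj₂ refl) (inj₂ refl) s≢o = ⊥-elim (s≢o refl)

    swap-moves-t : swapL i f t ≡ y
    swap-moves-t = moves i-side f-side (≢-sym (farther-≢ m u))
      where
      moves : ∀ {s o} → s ≡ y ⊎ s ≡ t → o ≡ y ⊎ o ≡ t → s ≢ o → swapL s o t ≡ y
      moves (inj₁ refl) (inj₂ refl) _ rewrite ≡ᵇ-false (≢-sym y≢t) | ≡ᵇ-refl t = refl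
      moves (inj₂ refl) (inj₁ refl) _ rewrite ≡ᵇ-refl t = refl
      moves (inj₁ refl) (inj₁ refl) s≢o = ⊥-elim (s≢o refl)
      moves (inj₂ refl) (inj₂ refl) s≢o = ⊥-elim (s≢o refl)

    swap-fixes-x : swapL i f x ≡ x
    swap-fixes-x rewrite ≡ᵇ-false (≢-sym centre-≢-x) | ≡ᵇ-false (≢-sym farther-≢-x) = refl

    preservesSides : PreservesSides (D-substitution μ m u) x V
    preservesSides {z} z∈V with z ∈? triple m
    ... | no z∉ = D-substitution-preservesSides μ m u (inj₂ z∉)
    ... | yes z∈ with others z∈ (λ z≡x → settled-∉V uq x-settled (subst (_∈ V) z≡x z∈V))
    ...   | inj₁ z≡y = ⊥-elim (settled-∉V uq (∈-++⁺ˡ y∈A) (subst (_∈ V) z≡y z∈V))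
    ...   | inj₂ refl rewrite no-attack | swap-moves-t | swap-fixes-x =
      compareᵇ-sameSide (sameSide-triple (≢-sym centre-≢-x) y∈ t∈ y≢x t≢x)

    commute : φ (suc ℓ) (D μ i u) ≡ D ν i (φ (suc ℓ) u)
    commute = φ-D-commute nb (positionsDistinct ⊆u) o
                (attacks-φ 0<a′ ⊆u o (⊥-elim ∘ centre-≢-x) (⊥-elim ∘ farther-≢-x)) preservesSides
      where
      o : SameOrderOn m u u′
      o = sameOrder-off-centre (≢-sym centre-≢-x)

  Hypothesis : Set
  Hypothesis = D μ i u ≡ u ⊎ x ∉ triple m ⊎ Σ ℕ (λ y → y ∈ A × y ∈ triple m)

  φ-D : 0 < a′ → Unique u → TripleIn → Hypothesis → φ (suc ℓ) (D μ i u) ≡ D ν i (φ (suc ℓ) u)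
  φ-D 0<a′ uq ⊆u = by-between (between i u) refl
    where
    by-between : ∀ β → between i u ≡ β → Hypothesis → φ (suc ℓ) (D μ i u) ≡ D ν i (φ (suc ℓ) u)
    by-between true b _ = begin
      φ (suc ℓ) (D μ i u)  ≡⟨ cong (φ (suc ℓ)) (D-between μ m u b) ⟩
      φ (suc ℓ) u          ≡⟨ φ-split A x V ⟩
      u′                   ≡⟨ sym (D-between ν m u′ (trans between-φ b)) ⟩
      D ν i u′             ≡⟨ cong (D ν i) (sym (φ-split A x V)) ⟩
      D ν i (φ (suc ℓ) u)  ∎
      where open ≡-Reasoning
    by-between false b (inj₁ fixed) =
      ⊥-elim (D-substitution-moves-centre μ m u
                (map-fixes (D-substitution μ m u) u (trans (sym (D-as-map μ m u b)) fixed) (⊆u centre)))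
    by-between false b (inj₂ (inj₁ x∉)) = φ-D-outside 0<a′ ⊆u x∉ b
    by-between false b (inj₂ (inj₂ (y , y∈A , y∈))) with x ∈? triple m
    ... | no x∉  = φ-D-outside 0<a′ ⊆u x∉ b
    ... | yes x∈ with all? (_∈? A ++ x ∷ []) (triple m)
    ...   | yes settled = φ-D-settled 0<a′ uq ⊆u (All.lookup settled) b
    ...   | no unsettled with find (¬All⇒Any¬ (_∈? A ++ x ∷ []) (triple m) unsettled)
    ...     | t , t∈ , t∉ = Straddling.commute 0<a′ uq ⊆u x∈ y∈A y∈ t∈ t∉ b

-- Permutations of [n]

perm-unique : ∀ {n} {u : List ℕ} → u ↭ map suc (upTo n) → Unique u
perm-unique {n} perm = Unique-resp-↭ (setoid ℕ) (↭⇒↭ₛ (↭-sym perm)) (map⁺ suc-injective (upTo⁺ n))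

perm-∈ : ∀ {n} {u : List ℕ} → u ↭ map suc (upTo n) → ∀ {s} → 0 < s → s ≤ n → s ∈ u
perm-∈ perm {suc s} _ s<n = ∈-resp-↭ (↭-sym perm) (∈-map⁺ suc (∈-upTo⁺ s<n))

perm-length : ∀ {n} {u : List ℕ} → u ↭ map suc (upTo n) → length u ≡ n
perm-length {n} perm = trans (↭-length perm) (trans (length-map suc (upTo n)) (length-upTo n))

split-at : ∀ k (u : List ℕ) → k < length u →
           Σ (List ℕ) λ A → Σ ℕ λ x → Σ (List ℕ) λ V → u ≡ A ++ x ∷ V × length A ≡ k
split-at zero    (x ∷ u) _        = [] , x , u , refl , refl
split-at (suc k) (y ∷ u) (s≤s lt) with split-at k u lt
... | A , x , V , refl , refl = y ∷ A , x , V , refl , refl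

letterAt-split : ∀ A x V → letterAt (A ++ x ∷ V) (suc (length A)) ≡ x
letterAt-split []      x V = refl
letterAt-split (a ∷ A) x V = letterAt-split A x V

letterAt-prefix : ∀ A R j → j < length A → letterAt (A ++ R) (suc j) ∈ A
letterAt-prefix (a ∷ A) R zero    _         = here refl
letterAt-prefix (a ∷ A) R (suc j) (s≤s j<l) = there (letterAt-prefix A R j j<l)

lemma4p2 : (n k i : ℕ) → 0 < k → k < n → 1 < i → i < n →
    (u : List ℕ) → u ↭ map suc (upTo n) →
    (D (hook (n ∸ k) k) i u ≡ u
      ⊎ letterAt u k ∉ (i ∸ 1 ∷ i ∷ suc i ∷ [])
      ⊎ Σ ℕ (λ j → 1 ≤ j × j < k × letterAt u j ∈ (i ∸ 1 ∷ i ∷ suc i ∷ []))) →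
    φ k (D (hook (n ∸ k) k) i u) ≡ D (hook (n ∸ k + 1) (k ∸ 1)) i (φ k u)
lemma4p2 n (suc k) (suc (suc m)) (s≤s z≤n) k<n (s≤s (s≤s z≤n)) i<n u perm hyp
  with split-at k u (subst (k <_) (sym (perm-length perm)) (<-trans (n<1+n k) k<n))
... | A , x , V , refl , refl =
  Split.φ-D (n ∸ suc k′) (n ∸ suc k′ + 1) (suc m) A x V (m≤n+m 1 _) (perm-unique perm) triple⊆u
            (Sum.map₂ (Sum.map (subst (_∉ triple (suc m)) (letterAt-split A x V)) in-prefix) hyp)
  where
  k′ = length A
  triple⊆u : ∀ {s} → s ∈ triple (suc m) → s ∈ A ++ x ∷ V
  triple⊆u s∈ = perm-∈ perm (≤-trans (s≤s z≤n) (proj₁ (triple-bounds s∈)))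
                            (≤-trans (proj₂ (triple-bounds s∈)) i<n)
  in-prefix : Σ ℕ (λ j → 1 ≤ j × j < suc k′ × letterAt (A ++ x ∷ V) j ∈ triple (suc m)) →
              Σ ℕ (λ y → y ∈ A × y ∈ triple (suc m))
  in-prefix (suc j , _ , s≤s j<k′ , y∈) = _ , letterAt-prefix A (x ∷ V) j j<k′ , y∈
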